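{- Let $\alpha\in(0,1)$ be irrational, let $a_0=0$ and $a_i=\lfloor (i+1)\alpha\rfloor-\lfloor i\alpha\rfloor$ for $i\ge 1$. For integers $i\ge 0$ and $m,n\ge 1$ put $T(i,m,n)=\sum_{k=0}^{m-1}\sum_{\ell=0}^{n-1}a_{i+k+\ell}$ and $\Delta(i,m,n)=T(i+1,m,n)-T(i,m,n)$. Then the set $\{T(i,m,n): i\ge 0\}$ has at most two elements if and only if the sequence $(\Delta(i,m,n))_{i\ge 0}$ contains no block (consecutive terms) of the form $1,0,0,\ldots,0,1$ or $-1,0,0,\ldots,0,-1$ (with zero or more $0$'s between the two nonzero entries).
   Context: $T(i,m,n)$ is the sum of the entries of the $m\times n$ Hankel matrix $(a_{i+k+\ell})_{0\le k<m,\,0\le \ell<n}$. The pair $(m,n)$ is called balanced if $T(i,m,n)$ takes at most two distinct values as $i$ ranges over $i\ge 0$. -}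

module Defs where

open import Data.Bool using (Bool; true; false; if_then_else_)
open import Data.Nat as ℕ using (ℕ; zero; suc)
open import Data.Integer as ℤ using (ℤ; +_; _-_)
open import Data.Rational as ℚ using (ℚ; _/_; 0ℚ; 1ℚ)
open import Data.Product using (∃; _×_)
open import Relation.Binary.PropositionalEquality using (_≡_)

-- An irrational real number α ∈ (0,1), represented by its (decidable)
-- Dedekind cut  lower q = true  ⇔  q < α.
record IrrationalIn01 : Set where
  field
    lower    : ℚ → Bool
    downward : ∀ p q → p ℚ.≤ q → lower q ≡ true → lower p ≡ true
    noMax    : ∀ q → lower q ≡ true → ∃ λ p → q ℚ.< p × lower p ≡ true
    -- the upper set {q | α ≤ q} has no least element, i.e. α is irrational
    noMin    : ∀ q → lower q ≡ false → ∃ λ p → p ℚ.< q × lower p ≡ false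
    zeroIn   : lower 0ℚ ≡ true
    oneOut   : lower 1ℚ ≡ false     -- α ≤ 1 (hence α < 1 by irrationality)

open IrrationalIn01 public

countBelow : IrrationalIn01 → (d : ℕ) → .{{_ : ℕ.NonZero d}} → ℕ → ℕ
countBelow α d zero    = 0
countBelow α d (suc c) =
  (if lower α ((+ suc c) / d) then 1 else 0) ℕ.+ countBelow α d c

-- ⌊ i α ⌋  = #{ k ≥ 1 | k < i α } = #{ 1 ≤ k ≤ i | k / i < α }  (as 0 < α < 1)
floorMul : IrrationalIn01 → ℕ → ℕ
floorMul α zero    = 0
floorMul α (suc j) = countBelow α (suc j) (suc j)

a : IrrationalIn01 → ℕ → ℤ
a α zero    = + 0
a α (suc j) = + floorMul α (suc (suc j)) - + floorMul α (suc j)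

sumTo : ℕ → (ℕ → ℤ) → ℤ
sumTo zero    f = + 0
sumTo (suc m) f = sumTo m f ℤ.+ f m

T : IrrationalIn01 → ℕ → ℕ → ℕ → ℤ
T α i m n = sumTo m (λ k → sumTo n (λ ℓ → a α (i ℕ.+ k ℕ.+ ℓ)))

Δ : IrrationalIn01 → ℕ → ℕ → ℕ → ℤ
Δ α i m n = T α (suc i) m n - T α i m n

AtMostTwoValues : IrrationalIn01 → ℕ → ℕ → Set
AtMostTwoValues α m n = ∀ i j k →
  (T α i m n ≡ T α j m n) ⊎' (T α i m n ≡ T α k m n) ⊎' (T α j m n ≡ T α k m n)
  where open import Data.Sum renaming (_⊎_ to _⊎'_)

HasBlock : IrrationalIn01 → ℕ → ℕ → ℤ → Set
HasBlock α m n s = ∃ λ i → ∃ λ j →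
  (Δ α i m n ≡ s) × (Δ α (i ℕ.+ suc j) m n ≡ s) ×
  (∀ t → 1 ℕ.≤ t → t ℕ.≤ j → Δ α (i ℕ.+ t) m n ≡ + 0)

{-# OPTIONS --safe #-}
-- Since ⌊α⌋ = 0, a_k = ⌊(k+1)α⌋ − ⌊kα⌋ holds for k = 0 as well, so the row sum
-- Σ_{ℓ<n} a_{j+ℓ} telescopes to ⌊(j+n)α⌋ − ⌊jα⌋ = ⌊nα⌋ + c_j, where the carry c_j is 0 or 1
-- because ⌊xα⌋ + ⌊yα⌋ ≤ ⌊(x+y)α⌋ ≤ ⌊xα⌋ + ⌊yα⌋ + 1 (the mediant of two fractions lies between
-- them).  Passing from i to i+1 trades row i for row i+m, so Δ(i) = c_{i+m} − c_i ∈ {−1,0,1}.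
-- For an integer sequence with such steps, a block s,0,…,0,s gives the three values T, T+s, T+2s;
-- without blocks the nonzero steps alternate in sign, so any two values differ by at most 1,
-- and three integers at pairwise distance ≤ 1 cannot be distinct.

module Submission where

open import Defs
open import Data.Nat using (ℕ; _≥_)
open import Data.Integer using (+_; -[1+_])
open import Data.Product using (_×_)
open import Relation.Nullary using (¬_)
open import Function.Bundles using (_⇔_)

open import Data.Bool using (Bool; true; false; if_then_else_)
open import Data.Nat using (zero; suc; _+_; _*_; _∸_; _≤_; _≤?_; z≤n; s≤s; s≤s⁻¹)
open import Data.Nat.Properties
  using (≤-refl; ≤-trans; ≤-antisym; ≤-total; ≤-reflexive; <-irrefl; <⇒≤; ≮⇒≥; ≰⇒≥; ≰⇒>; m≤n⇒m≤1+n; n≤1+n;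
         m≤n⇒m<n∨m≡n; m∸n+n≡m; n≤0⇒n≡0; +-suc; +-comm; +-identityʳ; *-identityˡ; *-identityʳ;
         *-distribˡ-+; *-distribʳ-+; +-monoˡ-≤; +-monoʳ-≤; *-monoˡ-≤; module ≤-Reasoning)
open import Data.Integer as ℤ using (ℤ; _-_; -_; 0ℤ; 1ℤ; -1ℤ)
open import Data.Integer.Properties
  using (i≡j⇒i-j≡0; i-j≡0⇒i≡j; +-inverseʳ; *-cancelˡ-≡; *-zeroʳ; pos-+; pos-*)
open import Data.Integer.Tactic.RingSolver using (solve-∀)
open import Data.Rational as ℚ using (ℚ; _/_; 0ℚ; 1ℚ)
open import Data.Rational.Properties using (toℚᵘ-cancel-≤; toℚᵘ-fromℚᵘ)
open import Data.Rational.Unnormalised using (mkℚᵘ; *≤*)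
open import Data.Rational.Unnormalised.Properties using (≤-respˡ-≃; ≤-respʳ-≃; ≃-sym)
open import Data.Product using (_,_; ∃)
open import Data.Sum using (_⊎_; inj₁; inj₂; [_,_]′)
open import Data.Empty using (⊥-elim)
open import Relation.Nullary using (yes; no)
open import Relation.Binary.PropositionalEquality
open import Function.Bundles using (mk⇔)

δ : (ℕ → ℤ) → ℕ → ℤ
δ f i = f (suc i) - f i

Increment : ℤ → Set
Increment d = d ≡ 0ℤ ⊎ d ≡ 1ℤ ⊎ d ≡ -1ℤ

increment-neg : ∀ {d} → Increment d → Increment (- d)
increment-neg (inj₁ refl)        = inj₁ refl
increment-neg (inj₂ (inj₁ refl)) = inj₂ (inj₂ refl)
increment-neg (inj₂ (inj₂ refl)) = inj₂ (inj₁ refl)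

three-increments : ∀ {u v} → Increment u → Increment v → Increment (v - u) → u ≡ 0ℤ ⊎ v ≡ 0ℤ ⊎ v - u ≡ 0ℤ
three-increments (inj₁ refl)        _                  _ = inj₁ refl
three-increments _                  (inj₁ refl)        _ = inj₂ (inj₁ refl)
three-increments (inj₂ (inj₁ refl)) (inj₂ (inj₁ refl)) _ = inj₂ (inj₂ refl)
three-increments (inj₂ (inj₂ refl)) (inj₂ (inj₂ refl)) _ = inj₂ (inj₂ refl)
three-increments (inj₂ (inj₁ refl)) (inj₂ (inj₂ refl)) (inj₁ ())
three-increments (inj₂ (inj₁ refl)) (inj₂ (inj₂ refl)) (inj₂ (inj₁ ()))
three-increments (inj₂ (inj₁ refl)) (inj₂ (inj₂ refl)) (inj₂ (inj₂ ()))
three-increments (inj₂ (inj₂ refl)) (inj₂ (inj₁ refl)) (inj₁ ())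
three-increments (inj₂ (inj₂ refl)) (inj₂ (inj₁ refl)) (inj₂ (inj₁ ()))
three-increments (inj₂ (inj₂ refl)) (inj₂ (inj₁ refl)) (inj₂ (inj₂ ()))

three-distinct : ∀ {x y z s} → s ≢ 0ℤ → y - x ≡ s → z - y ≡ s → ¬ (x ≡ y ⊎ x ≡ z ⊎ y ≡ z)
three-distinct s≢0 y-x≡s _     (inj₁ x≡y)        = s≢0 (trans (sym y-x≡s) (i≡j⇒i-j≡0 (sym x≡y)))
three-distinct s≢0 _     z-y≡s (inj₂ (inj₂ y≡z)) = s≢0 (trans (sym z-y≡s) (i≡j⇒i-j≡0 (sym y≡z)))
three-distinct {x} {y} {z} {s} s≢0 y-x≡s z-y≡s (inj₂ (inj₁ x≡z)) = s≢0 (*-cancelˡ-≡ (+ 2) s 0ℤ 2s≡2*0)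
  where
  split : ∀ x y z → z - x ≡ (z - y) ℤ.+ (y - x)
  split = solve-∀
  double : ∀ s → s ℤ.+ s ≡ + 2 ℤ.* s
  double = solve-∀
  2s≡2*0 : + 2 ℤ.* s ≡ + 2 ℤ.* 0ℤ
  2s≡2*0 = begin
    + 2 ℤ.* s            ≡⟨ double s ⟨
    s ℤ.+ s              ≡⟨ cong₂ ℤ._+_ z-y≡s y-x≡s ⟨
    (z - y) ℤ.+ (y - x)  ≡⟨ split x y z ⟨
    z - x                ≡⟨ i≡j⇒i-j≡0 (sym x≡z) ⟩
    0ℤ                   ≡⟨ *-zeroʳ (+ 2) ⟨
    + 2 ℤ.* 0ℤ           ∎
    where open ≡-Reasoning

TwoValued : (ℕ → ℤ) → Set
TwoValued f = ∀ i j k → f i ≡ f j ⊎ f i ≡ f k ⊎ f j ≡ f k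

Flat : (ℕ → ℤ) → ℕ → ℕ → Set
Flat D p z = ∀ t → 1 ≤ t → t ≤ z → D (p + t) ≡ 0ℤ

Block : (ℕ → ℤ) → ℤ → Set
Block D s = ∃ λ i → ∃ λ j → D i ≡ s × D (i + suc j) ≡ s × Flat D i j

data Pending (D : ℕ → ℤ) (s : ℤ) : ℕ → Set where
  pending : ∀ {p z} → D p ≡ s → Flat D p z → Pending D s (p + suc z)

module _ {D : ℕ → ℤ} {s : ℤ} where

  pending-start : ∀ {y} → D y ≡ s → Pending D s (suc y)
  pending-start {y} Dy≡s = subst (Pending D s) (+-comm y 1) (pending Dy≡s λ { zero () _ ; (suc _) _ () })

  pending-extend : ∀ {y} → Pending D s y → D y ≡ 0ℤ → Pending D s (suc y)
  pending-extend (pending {p} {z} Dp≡s flat) Dy≡0 = subst (Pending D s) (+-suc p (suc z)) (pending Dp≡s flat′)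
    where
    flat′ : Flat D p (suc z)
    flat′ t 1≤t t≤1+z with m≤n⇒m<n∨m≡n t≤1+z
    ... | inj₁ t<1+z = flat t 1≤t (s≤s⁻¹ t<1+z)
    ... | inj₂ refl  = Dy≡0

  pending-block : ∀ {y} → Pending D s y → D y ≡ s → Block D s
  pending-block (pending {p} {z} Dp≡s flat) Dy≡s = p , z , Dp≡s , Dy≡s , flat

module _ (f : ℕ → ℤ) where

  flat⇒constant : ∀ {p z} → Flat (δ f) p z → ∀ t → t ≤ z → f (p + suc t) ≡ f (suc p)
  flat⇒constant {p} flat zero    _   = cong f (+-comm p 1)
  flat⇒constant {p} flat (suc t) t<z = begin
    f (p + suc (suc t))  ≡⟨ cong f (+-suc p (suc t)) ⟩
    f (suc (p + suc t))  ≡⟨ i-j≡0⇒i≡j _ _ (flat (suc t) (s≤s z≤n) t<z) ⟩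
    f (p + suc t)        ≡⟨ flat⇒constant flat t (<⇒≤ t<z) ⟩
    f (suc p)            ∎
    where open ≡-Reasoning

  block⇒¬twoValued : ∀ {s} → s ≢ 0ℤ → Block (δ f) s → ¬ TwoValued f
  block⇒¬twoValued {s} s≢0 (i , j , δi≡s , δk≡s , flat) twoValued =
    three-distinct s≢0 δi≡s second-step (twoValued i (suc i) (suc (i + suc j)))
    where
    second-step : f (suc (i + suc j)) - f (suc i) ≡ s
    second-step = trans (cong (λ w → f (suc (i + suc j)) - w) (sym (flat⇒constant flat j ≤-refl))) δk≡s

  module _ (no-up : ¬ Block (δ f) 1ℤ) (no-down : ¬ Block (δ f) -1ℤ) (step : ∀ i → Increment (δ f i)) where

    -- Once f has moved away from f x by ±1, the last nonzero step is still pending: repeating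
    -- it would complete a block, so the next nonzero step must bring f back to f x.
    Reach : ℕ → ℕ → Set
    Reach x y = f y - f x ≡ 0ℤ
              ⊎ (f y - f x ≡ 1ℤ × Pending (δ f) 1ℤ y)
              ⊎ (f y - f x ≡ -1ℤ × Pending (δ f) -1ℤ y)

    reach-suc : ∀ {x y} → Reach x y → Reach x (suc y)
    reach-suc {x} {y} reach = go reach (step y)
      where
      next : ∀ {e d} → f y - f x ≡ e → δ f y ≡ d → f (suc y) - f x ≡ e ℤ.+ d
      next {e} {d} e≡ d≡ = trans (split (f x) (f y) (f (suc y))) (cong₂ ℤ._+_ e≡ d≡)
        where
        split : ∀ a b c → c - a ≡ (b - a) ℤ.+ (c - b)
        split = solve-∀
      go : Reach x y → Increment (δ f y) → Reach x (suc y)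
      go (inj₁ e)              (inj₁ d)        = inj₁ (next e d)
      go (inj₁ e)              (inj₂ (inj₁ d)) = inj₂ (inj₁ (next e d , pending-start d))
      go (inj₁ e)              (inj₂ (inj₂ d)) = inj₂ (inj₂ (next e d , pending-start d))
      go (inj₂ (inj₁ (e , p))) (inj₁ d)        = inj₂ (inj₁ (next e d , pending-extend p d))
      go (inj₂ (inj₁ (e , p))) (inj₂ (inj₁ d)) = ⊥-elim (no-up (pending-block p d))
      go (inj₂ (inj₁ (e , p))) (inj₂ (inj₂ d)) = inj₁ (next e d)
      go (inj₂ (inj₂ (e , p))) (inj₁ d)        = inj₂ (inj₂ (next e d , pending-extend p d))
      go (inj₂ (inj₂ (e , p))) (inj₂ (inj₁ d)) = inj₁ (next e d)
      go (inj₂ (inj₂ (e , p))) (inj₂ (inj₂ d)) = ⊥-elim (no-down (pending-block p d))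

    reach : ∀ x d → Reach x (d + x)
    reach x zero    = inj₁ (+-inverseʳ (f x))
    reach x (suc d) = reach-suc (reach x d)

    reach⇒increment : ∀ {x y} → Reach x y → Increment (f y - f x)
    reach⇒increment (inj₁ e)              = inj₁ e
    reach⇒increment (inj₂ (inj₁ (e , _))) = inj₂ (inj₁ e)
    reach⇒increment (inj₂ (inj₂ (e , _))) = inj₂ (inj₂ e)

    difference-increment : ∀ x y → Increment (f y - f x)
    difference-increment x y with ≤-total x y
    ... | inj₁ x≤y = subst (λ z → Increment (f z - f x)) (m∸n+n≡m x≤y) (reach⇒increment (reach x (y ∸ x)))
    ... | inj₂ y≤x = subst Increment (swap (f x) (f y))
                       (increment-neg (subst (λ z → Increment (f z - f y)) (m∸n+n≡m y≤x) (reach⇒increment (reach y (x ∸ y)))))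
      where
      swap : ∀ a b → - (a - b) ≡ b - a
      swap = solve-∀

increments⇒twoValued : (f : ℕ → ℤ) → (∀ x y → Increment (f y - f x)) → TwoValued f
increments⇒twoValued f inc i j k = conclude (three-increments (inc i j) (inc i k) (subst Increment fk-fj (inc j k)))
  where
  via-i : ∀ a b c → c - b ≡ (c - a) - (b - a)
  via-i = solve-∀
  fk-fj : f k - f j ≡ (f k - f i) - (f j - f i)
  fk-fj = via-i (f i) (f j) (f k)
  conclude : f j - f i ≡ 0ℤ ⊎ f k - f i ≡ 0ℤ ⊎ (f k - f i) - (f j - f i) ≡ 0ℤ →
             f i ≡ f j ⊎ f i ≡ f k ⊎ f j ≡ f k
  conclude (inj₁ fj-fi≡0)        = inj₁ (sym (i-j≡0⇒i≡j _ _ fj-fi≡0))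
  conclude (inj₂ (inj₁ fk-fi≡0)) = inj₂ (inj₁ (sym (i-j≡0⇒i≡j _ _ fk-fi≡0)))
  conclude (inj₂ (inj₂ d≡0))     = inj₂ (inj₂ (sym (i-j≡0⇒i≡j _ _ (trans fk-fj d≡0))))

twoValued⇔noBlocks : (f : ℕ → ℤ) → (∀ i → Increment (δ f i)) →
                     TwoValued f ⇔ (¬ Block (δ f) 1ℤ × ¬ Block (δ f) -1ℤ)
twoValued⇔noBlocks f step = mk⇔
  (λ twoValued → (λ b → block⇒¬twoValued f (λ ()) b twoValued) , (λ b → block⇒¬twoValued f (λ ()) b twoValued))
  (λ (no-up , no-down) → increments⇒twoValued f (difference-increment f no-up no-down step))

sumTo-cong : ∀ m {F G : ℕ → ℤ} → (∀ k → F k ≡ G k) → sumTo m F ≡ sumTo m G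
sumTo-cong zero    F≗G = refl
sumTo-cong (suc m) F≗G = cong₂ ℤ._+_ (sumTo-cong m F≗G) (F≗G m)

sumTo-sub : ∀ m (F G : ℕ → ℤ) → sumTo m (λ k → F k - G k) ≡ sumTo m F - sumTo m G
sumTo-sub zero    F G = refl
sumTo-sub (suc m) F G = begin
  sumTo m (λ k → F k - G k) ℤ.+ (F m - G m)  ≡⟨ cong (ℤ._+ (F m - G m)) (sumTo-sub m F G) ⟩
  (sumTo m F - sumTo m G) ℤ.+ (F m - G m)    ≡⟨ regroup (sumTo m F) (sumTo m G) (F m) (G m) ⟩
  (sumTo m F ℤ.+ F m) - (sumTo m G ℤ.+ G m)  ∎
  where
  open ≡-Reasoning
  regroup : ∀ a b c d → (a - b) ℤ.+ (c - d) ≡ (a ℤ.+ c) - (b ℤ.+ d)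
  regroup = solve-∀

sumTo-telescope : ∀ (F : ℕ → ℤ) j m → sumTo m (λ k → F (suc (j + k)) - F (j + k)) ≡ F (j + m) - F j
sumTo-telescope F j zero = begin
  0ℤ               ≡⟨ +-inverseʳ (F j) ⟨
  F j - F j        ≡⟨ cong (λ x → F x - F j) (+-identityʳ j) ⟨
  F (j + 0) - F j  ∎
  where open ≡-Reasoning
sumTo-telescope F j (suc m) = begin
  sumTo m (λ k → F (suc (j + k)) - F (j + k)) ℤ.+ (F (suc (j + m)) - F (j + m))
    ≡⟨ cong (ℤ._+ (F (suc (j + m)) - F (j + m))) (sumTo-telescope F j m) ⟩
  (F (j + m) - F j) ℤ.+ (F (suc (j + m)) - F (j + m))
    ≡⟨ collapse (F j) (F (j + m)) (F (suc (j + m))) ⟩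
  F (suc (j + m)) - F j
    ≡⟨ cong (λ x → F x - F j) (+-suc j m) ⟨
  F (j + suc m) - F j
    ∎
  where
  open ≡-Reasoning
  collapse : ∀ a b c → (b - a) ℤ.+ (c - b) ≡ c - a
  collapse = solve-∀

Bit : ℤ → Set
Bit b = b ≡ 0ℤ ⊎ b ≡ 1ℤ

bit-sub : ∀ {u v} → Bit u → Bit v → Increment (u - v)
bit-sub (inj₁ refl) (inj₁ refl) = inj₁ refl
bit-sub (inj₁ refl) (inj₂ refl) = inj₂ (inj₂ refl)
bit-sub (inj₂ refl) (inj₁ refl) = inj₂ (inj₁ refl)
bit-sub (inj₂ refl) (inj₂ refl) = inj₁ refl

x≤y≤1+x⇒bit : ∀ {x y} → x ≤ y → y ≤ suc x → Bit (+ y - + x)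
x≤y≤1+x⇒bit {x} {y} x≤y y≤1+x with m≤n⇒m<n∨m≡n y≤1+x
... | inj₁ (s≤s y≤x) = inj₁ (trans (cong (λ z → + z - + x) (≤-antisym y≤x x≤y)) (+-inverseʳ (+ x)))
... | inj₂ refl      = inj₂ (trans (cong (_- + x) (pos-+ 1 x)) (cancel (+ x)))
  where
  cancel : ∀ a → (1ℤ ℤ.+ a) - a ≡ 1ℤ
  cancel = solve-∀

-- Opaque: otherwise unification unfolds the normalising division _/_ and checking becomes very slow.
opaque
  _/1+_ : ℕ → ℕ → ℚ
  p /1+ d = + p / suc d

opaque
  unfolding _/1+_

  /1+-mono-≤ : ∀ p i q j → p * suc j ≤ q * suc i → p /1+ i ℚ.≤ q /1+ j
  /1+-mono-≤ p i q j cross = toℚᵘ-cancel-≤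
    (≤-respˡ-≃ (≃-sym (toℚᵘ-fromℚᵘ (mkℚᵘ (+ p) i)))
    (≤-respʳ-≃ (≃-sym (toℚᵘ-fromℚᵘ (mkℚᵘ (+ q) j)))
    (*≤* (subst₂ ℤ._≤_ (pos-* p (suc j)) (pos-* q (suc i)) (ℤ.+≤+ cross)))))

  1/1+0≡1 : 1 /1+ 0 ≡ 1ℚ
  1/1+0≡1 = refl

  0/1+0≡0 : 0 /1+ 0 ≡ 0ℚ
  0/1+0≡0 = refl

mediant-≤ʳ : ∀ p q {u v} → p * v ≤ q * u → (p + q) * v ≤ q * (u + v)
mediant-≤ʳ p q {u} {v} cross = begin
  (p + q) * v      ≡⟨ *-distribʳ-+ v p q ⟩
  p * v + q * v    ≤⟨ +-monoˡ-≤ (q * v) cross ⟩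
  q * u + q * v    ≡⟨ *-distribˡ-+ q u v ⟨
  q * (u + v)      ∎
  where open ≤-Reasoning

mediant-≥ˡ : ∀ p q {u v} → p * v ≤ q * u → p * (u + v) ≤ (p + q) * u
mediant-≥ˡ p q {u} {v} cross = begin
  p * (u + v)      ≡⟨ *-distribˡ-+ p u v ⟩
  p * u + p * v    ≤⟨ +-monoʳ-≤ (p * u) cross ⟩
  p * u + q * u    ≡⟨ *-distribʳ-+ u p q ⟨
  (p + q) * u      ∎
  where open ≤-Reasoning

mediant-comm : ∀ p i q j → (p + q) /1+ (i + suc j) ≡ (q + p) /1+ (j + suc i)
mediant-comm p i q j = cong₂ _/1+_ (+-comm p q) (trans (+-suc i j) (trans (cong suc (+-comm i j)) (sym (+-suc j i))))

count : (ℕ → Bool) → ℕ → ℕ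
count P zero    = 0
count P (suc c) = (if P (suc c) then 1 else 0) + count P c

count-≤ : ∀ P c → count P c ≤ c
count-≤ P zero = z≤n
count-≤ P (suc c) with P (suc c)
... | true  = s≤s (count-≤ P c)
... | false = m≤n⇒m≤1+n (count-≤ P c)

module _ (P : ℕ → Bool) (P-down : ∀ {k k′} → k ≤ k′ → P k′ ≡ true → P k ≡ true) where

  count-true : P 0 ≡ true → ∀ c → P (count P c) ≡ true
  count-true P0 zero = P0
  count-true P0 (suc c) with P (suc c) in P[1+c]
  ... | true  = P-down (s≤s (count-≤ P c)) P[1+c]
  ... | false = count-true P0 c

  count-greatest : ∀ c {k} → P k ≡ true → k ≤ c → k ≤ count P c
  count-greatest zero    _   k≤0   = k≤0
  count-greatest (suc c) Pk  k≤1+c with P (suc c) in P[1+c]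
  ... | true  = ≤-trans k≤1+c (s≤s (count-greatest c (P-down (n≤1+n c) P[1+c]) ≤-refl))
  ... | false with m≤n⇒m<n∨m≡n k≤1+c
  ...   | inj₁ (s≤s k≤c) = count-greatest c Pk k≤c
  ...   | inj₂ refl with () ← trans (sym Pk) P[1+c]

module Beatty (α : IrrationalIn01) where

  infix 4 _<α

  _<α : ℚ → Set
  x <α = lower α x ≡ true

  numerator-mono : ∀ {d k k′} → k ≤ k′ → k′ /1+ d <α → k /1+ d <α
  numerator-mono {d} {k} {k′} k≤k′ = downward α _ _ (/1+-mono-≤ k d k′ d (*-monoˡ-≤ (suc d) k≤k′))

  zero<α : ∀ d → 0 /1+ d <α
  zero<α d = downward α _ _ (/1+-mono-≤ 0 d 0 0 z≤n) (subst _<α (sym 0/1+0≡0) (zeroIn α))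

  ¬1<α : ¬ (1 /1+ 0 <α)
  ¬1<α 1<α with () ← trans (sym 1<α) (trans (cong (lower α) 1/1+0≡1) (oneOut α))

  ¬suc-d<α : ∀ d → ¬ (suc d /1+ d <α)
  ¬suc-d<α d 1+d<α = ¬1<α (downward α _ _ (/1+-mono-≤ 1 0 (suc d) d 1*[1+d]≤[1+d]*1) 1+d<α)
    where
    1*[1+d]≤[1+d]*1 : 1 * suc d ≤ suc d * 1
    1*[1+d]≤[1+d]*1 = ≤-reflexive (trans (*-identityˡ (suc d)) (sym (*-identityʳ (suc d))))

  numerator<α⇒≤ : ∀ {d k} → k /1+ d <α → k ≤ d
  numerator<α⇒≤ {d} {k} k<α with k ≤? d
  ... | yes k≤d = k≤d
  ... | no k≰d  = ⊥-elim (¬suc-d<α d (numerator-mono (≰⇒> k≰d) k<α))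

  mediant-<α : ∀ p i q j → p /1+ i <α → q /1+ j <α → (p + q) /1+ (i + suc j) <α
  mediant-<α p i q j p<α q<α with p * suc j ≤? q * suc i
  ... | yes cross = downward α _ _ (/1+-mono-≤ (p + q) _ q j (mediant-≤ʳ p q cross)) q<α
  ... | no cross  = subst _<α (mediant-comm q j p i)
                      (downward α _ _ (/1+-mono-≤ (q + p) _ p i (mediant-≤ʳ q p (≰⇒≥ cross))) p<α)

  mediant-<α⁻¹ : ∀ p i q j → (p + q) /1+ (i + suc j) <α → p /1+ i <α ⊎ q /1+ j <α
  mediant-<α⁻¹ p i q j m<α with p * suc j ≤? q * suc i
  ... | yes cross = inj₁ (downward α _ _ (/1+-mono-≤ p i (p + q) _ (mediant-≥ˡ p q cross)) m<α)
  ... | no cross  = inj₂ (downward α _ _ (/1+-mono-≤ q j (q + p) _ (mediant-≥ˡ q p (≰⇒≥ cross)))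
                           (subst _<α (mediant-comm p i q j) m<α))

  opaque
    ⌊_·α⌋ : ℕ → ℕ
    ⌊ j ·α⌋ = floorMul α j

  opaque
    unfolding _/1+_ ⌊_·α⌋

    ⌊0·α⌋≡0 : ⌊ 0 ·α⌋ ≡ 0
    ⌊0·α⌋≡0 = refl

    a-suc : ∀ k → a α (suc k) ≡ + ⌊ suc (suc k) ·α⌋ - + ⌊ suc k ·α⌋
    a-suc k = refl

    countBelow≡count : ∀ d c → countBelow α (suc d) c ≡ count (λ k → lower α (k /1+ d)) c
    countBelow≡count d zero    = refl
    countBelow≡count d (suc c) = cong (λ x → (if lower α (suc c /1+ d) then 1 else 0) + x) (countBelow≡count d c)

    ⌊⌋≡count : ∀ d → ⌊ suc d ·α⌋ ≡ count (λ k → lower α (k /1+ d)) (suc d)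
    ⌊⌋≡count d = countBelow≡count d (suc d)

  ⌊⌋-<α : ∀ d → ⌊ suc d ·α⌋ /1+ d <α
  ⌊⌋-<α d = subst (λ w → w /1+ d <α) (sym (⌊⌋≡count d)) (count-true _ (numerator-mono {d}) (zero<α d) (suc d))

  ⌊⌋-greatest : ∀ d {k} → k /1+ d <α → k ≤ ⌊ suc d ·α⌋
  ⌊⌋-greatest d {k} k<α = subst (k ≤_) (sym (⌊⌋≡count d))
                            (count-greatest _ (numerator-mono {d}) (suc d) k<α (m≤n⇒m≤1+n (numerator<α⇒≤ k<α)))

  ¬1+⌊⌋<α : ∀ d → ¬ (suc ⌊ suc d ·α⌋ /1+ d <α)
  ¬1+⌊⌋<α d 1+⌊⌋<α = <-irrefl refl (⌊⌋-greatest d 1+⌊⌋<α)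

  ⌊1·α⌋≡0 : ⌊ 1 ·α⌋ ≡ 0
  ⌊1·α⌋≡0 = n≤0⇒n≡0 (numerator<α⇒≤ (⌊⌋-<α 0))

  ⌊⌋-+ : ∀ j n → ⌊ j ·α⌋ + ⌊ n ·α⌋ ≤ ⌊ j + n ·α⌋ × ⌊ j + n ·α⌋ ≤ suc (⌊ j ·α⌋ + ⌊ n ·α⌋)
  ⌊⌋-+ zero    n    rewrite ⌊0·α⌋≡0 = ≤-refl , n≤1+n _
  ⌊⌋-+ (suc i) zero rewrite ⌊0·α⌋≡0 | +-identityʳ (suc i) | +-identityʳ ⌊ suc i ·α⌋ = ≤-refl , n≤1+n _
  ⌊⌋-+ (suc i) (suc j) = lower-bound , upper-bound
    where
    d = i + suc j
    F = ⌊ suc i ·α⌋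
    G = ⌊ suc j ·α⌋
    lower-bound : F + G ≤ ⌊ suc d ·α⌋
    lower-bound = ⌊⌋-greatest d (mediant-<α F i G j (⌊⌋-<α i) (⌊⌋-<α j))
    upper-bound : ⌊ suc d ·α⌋ ≤ suc (F + G)
    upper-bound = ≮⇒≥ λ 1+F+G<⌊⌋ →
      [ ¬1+⌊⌋<α i , ¬1+⌊⌋<α j ]′ (mediant-<α⁻¹ (suc F) i (suc G) j
        (numerator-mono (subst (_≤ ⌊ suc d ·α⌋) (cong suc (sym (+-suc F G))) 1+F+G<⌊⌋) (⌊⌋-<α d)))

  carry : ℕ → ℕ → ℤ
  carry j n = + ⌊ j + n ·α⌋ - (+ ⌊ j ·α⌋ ℤ.+ + ⌊ n ·α⌋)

  carry-bit : ∀ j n → Bit (carry j n)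
  carry-bit j n with ⌊⌋-+ j n
  ... | lower-bound , upper-bound =
    subst (λ x → Bit (+ ⌊ j + n ·α⌋ - x)) (pos-+ ⌊ j ·α⌋ ⌊ n ·α⌋) (x≤y≤1+x⇒bit lower-bound upper-bound)

  a-floor : ∀ k → a α k ≡ + ⌊ suc k ·α⌋ - + ⌊ k ·α⌋
  a-floor zero    = cong₂ (λ x y → + x - + y) (sym ⌊1·α⌋≡0) (sym ⌊0·α⌋≡0)
  a-floor (suc k) = a-suc k

  rowSum : ℕ → ℕ → ℤ
  rowSum n j = sumTo n (λ ℓ → a α (j + ℓ))

  rowSum-carry : ∀ n j → rowSum n j ≡ + ⌊ n ·α⌋ ℤ.+ carry j n
  rowSum-carry n j = begin
    rowSum n j                                            ≡⟨ sumTo-cong n (λ ℓ → a-floor (j + ℓ)) ⟩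
    sumTo n (λ ℓ → + ⌊ suc (j + ℓ) ·α⌋ - + ⌊ j + ℓ ·α⌋)  ≡⟨ sumTo-telescope (λ x → + ⌊ x ·α⌋) j n ⟩
    + ⌊ j + n ·α⌋ - + ⌊ j ·α⌋                             ≡⟨ regroup (+ ⌊ j + n ·α⌋) (+ ⌊ j ·α⌋) (+ ⌊ n ·α⌋) ⟩
    + ⌊ n ·α⌋ ℤ.+ carry j n                               ∎
    where
    open ≡-Reasoning
    regroup : ∀ x y z → x - y ≡ z ℤ.+ (x - (y ℤ.+ z))
    regroup = solve-∀

  Δ-rowSum : ∀ i m n → Δ α i m n ≡ rowSum n (i + m) - rowSum n i
  Δ-rowSum i m n = trans (sym (sumTo-sub m (λ k → rowSum n (suc (i + k))) (λ k → rowSum n (i + k))))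
                         (sumTo-telescope (rowSum n) i m)

  Δ-increment : ∀ i m n → Increment (Δ α i m n)
  Δ-increment i m n = subst Increment (sym Δ≡carry-carry) (bit-sub (carry-bit (i + m) n) (carry-bit i n))
    where
    cancel : ∀ c x y → (c ℤ.+ x) - (c ℤ.+ y) ≡ x - y
    cancel = solve-∀
    Δ≡carry-carry : Δ α i m n ≡ carry (i + m) n - carry i n
    Δ≡carry-carry = trans (Δ-rowSum i m n)
      (trans (cong₂ _-_ (rowSum-carry n (i + m)) (rowSum-carry n i)) (cancel (+ ⌊ n ·α⌋) (carry (i + m) n) (carry i n)))

lemma1 : (α : IrrationalIn01) (m n : ℕ) → m ≥ 1 → n ≥ 1 →
    AtMostTwoValues α m n ⇔ (¬ HasBlock α m n (+ 1) × ¬ HasBlock α m n -[1+ 0 ])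
lemma1 α m n _ _ = twoValued⇔noBlocks (λ i → T α i m n) (λ i → Δ-increment i m n)
  where open Beatty α
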